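{- For every integer $k\ge1$, as rational functions in $x$ (the left side being the power series expansion of the right side), \[ \sum_{n\ge0}(-1)^{n+1}\sum_{\pi\in\widetilde{\mathrm{PV}}^{3,3k}_n}\mathrm{wt}(\pi)x^n=\cfrac{1}{ -V_0x-1-\cfrac{1}{ -V_1x-1-\cdots-\cfrac{1}{ -V_{3k}x-1}}}. \]
   Context: $V_0,V_1,\dots$ are indeterminates; $\mathrm{wt}((a_1,\dots,a_N))=V_{a_1}\cdots V_{a_N}$ and the empty sequence has weight $1$. A modified $3$-peak-valley sequence is a sequence $(a_1,\dots,a_N)$ of nonnegative integers such that, setting $a_0=a_{N+1}=0$, for each $i=1,\dots,N$: if $a_i\equiv1\pmod3$ then $a_{i-1}>a_i<a_{i+1}$, and if $a_i\equiv2\pmod3$ then $a_{i-1}<a_i>a_{i+1}$. $\widetilde{\mathrm{PV}}^{3,K}_N$ is the set of such sequences of length $N$ with $0\le a_i\le K$; $\widetilde{\mathrm{PV}}^{3,K}_0$ consists of the empty sequence. -}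

module Defs where

open import Level using (Level)
open import Algebra.Bundles using (CommutativeRing)
open import Data.Nat as ℕ using (ℕ; zero; suc; _∸_; _%_; _<_; _>_; _≤_; _≤?_; _<?_)
open import Data.Nat.Properties using (_≟_)
open import Data.List as List using (List; []; _∷_; _++_; [_]; upTo; filter; concatMap; map; foldr; length)
open import Data.List.Relation.Unary.All as All using (All)
open import Data.Product using (_×_; _,_; proj₁; proj₂)
open import Data.Unit using (⊤; tt)
open import Relation.Binary.PropositionalEquality using (_≡_)
open import Relation.Nullary using (Dec; yes; no)
open import Relation.Nullary.Decidable using (_×-dec_; _→-dec_)

PVCond : ℕ → ℕ → ℕ → Set
PVCond p a q = (a % 3 ≡ 1 → (p > a × a < q)) × (a % 3 ≡ 2 → (p < a × a > q))

pvCond? : ∀ p a q → Dec (PVCond p a q)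
pvCond? p a q = ((a % 3 ≟ 1) →-dec ((a <? p) ×-dec (a <? q)))
           ×-dec ((a % 3 ≟ 2) →-dec ((p <? a) ×-dec (q <? a)))

ValidPadded : List ℕ → Set
ValidPadded (p ∷ a ∷ q ∷ rest) = PVCond p a q × ValidPadded (a ∷ q ∷ rest)
ValidPadded _ = ⊤

validPadded? : ∀ xs → Dec (ValidPadded xs)
validPadded? (p ∷ a ∷ q ∷ rest) = pvCond? p a q ×-dec validPadded? (a ∷ q ∷ rest)
validPadded? [] = yes tt
validPadded? (_ ∷ []) = yes tt
validPadded? (_ ∷ _ ∷ []) = yes tt

IsModPV : ℕ → List ℕ → Set
IsModPV K as = All (_≤ K) as × ValidPadded (0 ∷ as ++ [ 0 ])

isModPV? : ∀ K as → Dec (IsModPV K as)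
isModPV? K as = All.all? (_≤? K) as ×-dec validPadded? (0 ∷ as ++ [ 0 ])

allSeqs : ℕ → ℕ → List (List ℕ)
allSeqs K zero = [] ∷ []
allSeqs K (suc N) = concatMap (λ a → map (a ∷_) (allSeqs K N)) (upTo (suc K))

-- the finite set  PV~^{3,K}_N  (as a duplicate-free list)
ModPV : ℕ → ℕ → List (List ℕ)
ModPV K N = filter (isModPV? K) (allSeqs K N)

-- Algebraic part over an arbitrary commutative ring R
-- (V_0, V_1, … are interpreted by an arbitrary assignment V : ℕ → R)

module _ {c ℓ : Level} (R : CommutativeRing c ℓ) where
  open CommutativeRing R

  Series : Set c
  Series = ℕ → Carrier

  sumR : List Carrier → Carrier
  sumR = foldr _+_ 0#

  mulS : Series → Series → Series
  mulS f g n = sumR (map (λ i → f i * g (n ∸ i)) (upTo (suc n)))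

  addS : Series → Series → Series
  addS f g n = f n + g n

  negS : Series → Series
  negS f n = - f n

  oneS : Series
  oneS zero = 1#
  oneS (suc _) = 0#

  signR : ℕ → Carrier
  signR zero = 1#
  signR (suc n) = - signR n

  wt : (ℕ → Carrier) → List ℕ → Carrier
  wt V as = foldr _*_ 1# (map V as)

  lhsSeries : (ℕ → Carrier) → ℕ → Series
  lhsSeries V K n = signR (suc n) * sumR (map (wt V) (ModPV K n))

  partialDen : (ℕ → Carrier) → ℕ → Series
  partialDen V j zero = - 1#
  partialDen V j (suc zero) = - V j
  partialDen V j (suc (suc _)) = 0#

  -- numerator/denominator of the finite continued fraction
  --   1 / (b_j - 1/(b_{j+1} - ⋯ - 1/b_{j+m})),   b_i = -V_i x - 1,
  -- evaluated formally:  1/(b - p/q) = q / (b q - p).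
  CF : (ℕ → Carrier) → ℕ → ℕ → Series × Series
  CF V j zero = oneS , partialDen V j
  CF V j (suc m) =
    let pq = CF V (suc j) m in
    proj₂ pq , addS (mulS (partialDen V j) (proj₂ pq)) (negS (proj₁ pq))

  cfNum : (ℕ → Carrier) → ℕ → ℕ → Series
  cfNum V j m = proj₁ (CF V j m)

  cfDen : (ℕ → Carrier) → ℕ → ℕ → Series
  cfDen V j m = proj₂ (CF V j m)

-- Call levels a and b compatible when each respects the other's type: a level ≡ 1 (mod 3)
-- must lie below its neighbours, a level ≡ 2 (mod 3) above them.  The modified peak-valley
-- condition at a position says exactly that the entry is compatible with both neighbours, so
-- the sequences counted are the walks 0, a₁, …, a_N, 0 along compatible pairs, and the left-hand
-- side is −g₀, where the signed generating functions g_p of the walks continuing from level p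
-- solve the linear system g_p = [p∼0] + Σ_a [p∼a] (−V_a x) g_a.
-- Compatibility is invariant under shifting both levels by 3, and a level ≥ 3 treats 0 and 1
-- alike and is never compatible with 2.  So for K = K′ + 3 a walk from level 3 + a is a walk of
-- the shifted system h (weights V_{3+·}, bound K′) followed by a continuation counted by g₂, that
-- is g_{3+a} = g₂ h_a.  Eliminating g₁ and g₂ expresses g₀ through h₀ by three levels of the
-- continued fraction, and induction on k for the shifted weights finishes the proof.

module Submission where

open import Defs
open import Algebra.Bundles using (CommutativeRing)
open import Algebra.Structures using (IsAbelianGroup)
open import Data.Bool using (Bool; true; false; if_then_else_; _∧_; T)
import Data.Bool.Properties as Bool
open import Data.List as List using (List; []; _∷_; _++_; [_]; map; upTo; concatMap; filter)
import Data.List.Properties as List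
open import Data.List.Relation.Unary.All as All using (All; []; _∷_)
import Data.List.Relation.Unary.All.Properties as All
open import Data.Nat as ℕ using (ℕ; zero; suc; _∸_; _%_; _<ᵇ_; _≤_; _<_; _>_)
import Data.Nat.Properties as ℕ
open import Data.Product using (_×_; _,_; proj₁; proj₂)
open import Data.Unit using (tt)
open import Function using (_∘_; id)
open import Function.Bundles using (Equivalence)
open import Relation.Binary.PropositionalEquality as ≡ using (_≡_)
open import Relation.Binary.Definitions using (WeaklyDecidable)
open import Relation.Nullary using (yes; no; does; proof)
open import Relation.Nullary.Reflects using (det; fromEquivalence)
open import Relation.Unary using (Decidable)
open import Algebra.Solver.Ring.AlmostCommutativeRing
  using (fromCommutativeRing; _-Raw-AlmostCommutative⟶_; Induced-equivalence)
import Algebra.Construct.Pointwise as Pointwise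
open import Algebra.Consequences.Setoid using (comm∧idˡ⇒id; comm∧distrˡ⇒distr)

admitsResidue : ℕ → ℕ → ℕ → Bool
admitsResidue 1 a b = a <ᵇ b
admitsResidue 2 a b = b <ᵇ a
admitsResidue _ _ _ = true

admits : ℕ → ℕ → Bool
admits a = admitsResidue (a % 3) a

compatible : ℕ → ℕ → Bool
compatible a b = admits a b ∧ admits b a

chain : ℕ → List ℕ → Bool
chain p [] = compatible p 0
chain p (a ∷ as) = compatible p a ∧ chain a as

head₀ : List ℕ → ℕ
head₀ [] = 0
head₀ (a ∷ _) = a

pvCond⇒admits : ∀ p a q → PVCond p a q → T (admits a p) × T (admits a q)
pvCond⇒admits p a q = go
  where
  go : (a % 3 ≡ 1 → p > a × a < q) × (a % 3 ≡ 2 → p < a × a > q) →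
       T (admitsResidue (a % 3) a p) × T (admitsResidue (a % 3) a q)
  go (valley , peak) with a % 3
  ... | 0 = tt , tt
  ... | 1 = let (a<p , a<q) = valley ≡.refl in ℕ.<⇒<ᵇ a<p , ℕ.<⇒<ᵇ a<q
  ... | 2 = let (p<a , q<a) = peak ≡.refl in ℕ.<⇒<ᵇ p<a , ℕ.<⇒<ᵇ q<a
  ... | suc (suc (suc _)) = tt , tt

admits⇒pvCond : ∀ p a q → T (admits a p) → T (admits a q) → PVCond p a q
admits⇒pvCond p a q = go
  where
  go : T (admitsResidue (a % 3) a p) → T (admitsResidue (a % 3) a q) →
       (a % 3 ≡ 1 → p > a × a < q) × (a % 3 ≡ 2 → p < a × a > q)
  go a↔p a↔q with a % 3
  ... | 0 = (λ ()) , (λ ())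
  ... | 1 = (λ _ → ℕ.<ᵇ⇒< a p a↔p , ℕ.<ᵇ⇒< a q a↔q) , (λ ())
  ... | 2 = (λ ()) , (λ _ → ℕ.<ᵇ⇒< p a a↔p , ℕ.<ᵇ⇒< q a a↔q)
  ... | suc (suc (suc _)) = (λ ()) , (λ ())

validPadded-∷ : ∀ p a as →
                ValidPadded (p ∷ a ∷ as ++ [ 0 ]) ≡ (PVCond p a (head₀ as) × ValidPadded (a ∷ as ++ [ 0 ]))
validPadded-∷ p a [] = ≡.refl
validPadded-∷ p a (_ ∷ _) = ≡.refl

private
  T-∧⇒× : ∀ {x y} → T (x ∧ y) → T x × T y
  T-∧⇒× = Equivalence.to Bool.T-∧

  ×⇒T-∧ : ∀ {x y} → T x × T y → T (x ∧ y)
  ×⇒T-∧ = Equivalence.from Bool.T-∧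

chain⇒validPadded : ∀ p as → T (chain p as) → T (admits p (head₀ as)) × ValidPadded (p ∷ as ++ [ 0 ])
chain⇒validPadded p [] c = proj₁ (T-∧⇒× c) , tt
chain⇒validPadded p (a ∷ as) c =
  let (p↔a , rest) = T-∧⇒× c
      (pa , ap) = T-∧⇒× p↔a
      (a-next , valid) = chain⇒validPadded a as rest
  in pa , ≡.subst id (≡.sym (validPadded-∷ p a as)) (admits⇒pvCond p a (head₀ as) ap a-next , valid)

validPadded⇒chain : ∀ p as → T (admits p (head₀ as)) → ValidPadded (p ∷ as ++ [ 0 ]) → T (chain p as)
validPadded⇒chain p [] pa _ = ×⇒T-∧ (pa , tt)
validPadded⇒chain p (a ∷ as) pa valid =
  let (pv , valid′) = ≡.subst id (validPadded-∷ p a as) valid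
      (ap , a-next) = pvCond⇒admits p a (head₀ as) pv
  in ×⇒T-∧ (×⇒T-∧ (pa , ap) , validPadded⇒chain a as a-next valid′)

allSeqs-bounded : ∀ K n → All (All (_≤ K)) (allSeqs K n)
allSeqs-bounded K zero = [] ∷ []
allSeqs-bounded K (suc n) = All.concat⁺ (All.map⁺ (All.applyUpTo⁺₁ (λ a → a) (suc K)
  (λ a<1+K → All.map⁺ (All.map (ℕ.≤-pred a<1+K ∷_) (allSeqs-bounded K n)))))

does-isModPV : ∀ K as → All (_≤ K) as → does (isModPV? K as) ≡ chain 0 as
does-isModPV K as bounded = det (proof (isModPV? K as))
  (fromEquivalence (λ c → bounded , proj₂ (chain⇒validPadded 0 as c))
                   (λ (_ , valid) → validPadded⇒chain 0 as tt valid))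

admitsResidue-shift : ∀ r a b → admitsResidue r (3 ℕ.+ a) (3 ℕ.+ b) ≡ admitsResidue r a b
admitsResidue-shift 0 a b = ≡.refl
admitsResidue-shift 1 a b = ≡.refl
admitsResidue-shift 2 a b = ≡.refl
admitsResidue-shift (suc (suc (suc _))) a b = ≡.refl

admitsResidue-below : ∀ r a b → admitsResidue r (suc a) 0 ≡ admitsResidue r (suc b) 0
admitsResidue-below 0 a b = ≡.refl
admitsResidue-below 1 a b = ≡.refl
admitsResidue-below 2 a b = ≡.refl
admitsResidue-below (suc (suc (suc _))) a b = ≡.refl

admitsResidue-1-0 : ∀ r a → admitsResidue r (3 ℕ.+ a) 1 ≡ admitsResidue r (3 ℕ.+ a) 0
admitsResidue-1-0 0 a = ≡.refl
admitsResidue-1-0 1 a = ≡.refl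
admitsResidue-1-0 2 a = ≡.refl
admitsResidue-1-0 (suc (suc (suc _))) a = ≡.refl

compatible-comm : ∀ a b → compatible a b ≡ compatible b a
compatible-comm a b = Bool.∧-comm (admits a b) (admits b a)

compatible-shift : ∀ a b → compatible (3 ℕ.+ a) (3 ℕ.+ b) ≡ compatible a b
compatible-shift a b = ≡.cong₂ _∧_ (admitsResidue-shift (a % 3) a b) (admitsResidue-shift (b % 3) b a)

compatible-high-0 : ∀ a → compatible (3 ℕ.+ a) 0 ≡ compatible a 0
compatible-high-0 zero = ≡.refl
compatible-high-0 (suc a) = ≡.cong (_∧ true) (admitsResidue-below (suc a % 3) (3 ℕ.+ a) a)

compatible-high-1 : ∀ a → compatible (3 ℕ.+ a) 1 ≡ compatible a 0
compatible-high-1 a = ≡.trans (≡.cong (_∧ true) (admitsResidue-1-0 (a % 3) a)) (compatible-high-0 a)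

compatible-high-2 : ∀ a → compatible (3 ℕ.+ a) 2 ≡ false
compatible-high-2 a = Bool.∧-zeroʳ (admits (3 ℕ.+ a) 2)

-- The ring solver needs coefficients with decidable equality, which over an arbitrary commutative
-- ring come from the canonical map ℤ → R.  The optimised multiple _·_ makes ⟦ + 1 ⟧ℤ equal to 1#
-- definitionally, so that :1 in solver goals denotes 1#.
module IntegerCoefficients {c ℓ} (R : CommutativeRing c ℓ) where
  open import Data.Integer as ℤ using (ℤ; +_; -[1+_]; _⊖_; _◃_; sign; ∣_∣)
  import Data.Integer.Properties as ℤ
  open import Data.Sign as Sign using (Sign)
  open import Data.Maybe using (just; nothing)
  open CommutativeRing R
  open import Algebra.Properties.Ring ring using (-0#≈0#; -‿involutive; -‿+-comm; -1*x≈-x)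
  open import Algebra.Properties.Semiring.Mult.TCOptimised semiring using (1+×; ×-homo-+; ×1-homo-*)
    renaming (_×_ to _·_)
  open import Algebra.Properties.CommutativeSemigroup +-commutativeSemigroup using (interchange)
  open import Algebra.Properties.CommutativeSemigroup *-commutativeSemigroup
    using () renaming (interchange to *-interchange)
  open import Relation.Binary.Reasoning.Setoid setoid

  ⟦_⟧ℤ : ℤ → Carrier
  ⟦ + n ⟧ℤ = n · 1#
  ⟦ -[1+ n ] ⟧ℤ = - (suc n · 1#)

  ⟦_⟧ₛ : Sign → Carrier
  ⟦ Sign.+ ⟧ₛ = 1#
  ⟦ Sign.- ⟧ₛ = - 1#

  ⊖-homo : ∀ m n → ⟦ m ⊖ n ⟧ℤ ≈ m · 1# - n · 1#
  ⊖-homo zero zero = sym (trans (+-congˡ -0#≈0#) (+-identityʳ 0#))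
  ⊖-homo (suc m) zero = sym (trans (+-congˡ -0#≈0#) (+-identityʳ _))
  ⊖-homo zero (suc n) = sym (+-identityˡ _)
  ⊖-homo (suc m) (suc n) = begin
    ⟦ suc m ⊖ suc n ⟧ℤ                 ≡⟨ ≡.cong ⟦_⟧ℤ (ℤ.[1+m]⊖[1+n]≡m⊖n m n) ⟩
    ⟦ m ⊖ n ⟧ℤ                         ≈⟨ ⊖-homo m n ⟩
    m · 1# - n · 1#                    ≈⟨ +-identityˡ _ ⟨
    0# + (m · 1# - n · 1#)             ≈⟨ +-congʳ (-‿inverseʳ 1#) ⟨
    (1# - 1#) + (m · 1# - n · 1#)      ≈⟨ interchange 1# (- 1#) (m · 1#) (- (n · 1#)) ⟩
    (1# + m · 1#) + (- 1# - n · 1#)    ≈⟨ +-congˡ (-‿+-comm 1# (n · 1#)) ⟩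
    (1# + m · 1#) - (1# + n · 1#)      ≈⟨ +-cong (1+× m 1#) (-‿cong (1+× n 1#)) ⟨
    suc m · 1# - suc n · 1#            ∎

  +-homo : ∀ i j → ⟦ i ℤ.+ j ⟧ℤ ≈ ⟦ i ⟧ℤ + ⟦ j ⟧ℤ
  +-homo (+ m) (+ n) = ×-homo-+ 1# m n
  +-homo (+ m) -[1+ n ] = ⊖-homo m (suc n)
  +-homo -[1+ m ] (+ n) = trans (⊖-homo n (suc m)) (+-comm _ _)
  +-homo -[1+ m ] -[1+ n ] = begin
    - (suc (suc (m ℕ.+ n)) · 1#)       ≡⟨ ≡.cong (λ k → - (suc k · 1#)) (ℕ.+-suc m n) ⟨
    - ((suc m ℕ.+ suc n) · 1#)         ≈⟨ -‿cong (×-homo-+ 1# (suc m) (suc n)) ⟩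
    - (suc m · 1# + suc n · 1#)        ≈⟨ -‿+-comm _ _ ⟨
    - (suc m · 1#) - (suc n · 1#)      ∎

  -‿homo : ∀ i → ⟦ ℤ.- i ⟧ℤ ≈ - ⟦ i ⟧ℤ
  -‿homo (+ zero) = sym -0#≈0#
  -‿homo (+ suc n) = refl
  -‿homo -[1+ n ] = sym (-‿involutive _)

  ◃-homo : ∀ s n → ⟦ s ◃ n ⟧ℤ ≈ ⟦ s ⟧ₛ * (n · 1#)
  ◃-homo s zero = sym (zeroʳ _)
  ◃-homo Sign.+ (suc n) = sym (*-identityˡ _)
  ◃-homo Sign.- (suc n) = sym (-1*x≈-x _)

  sign-homo : ∀ s t → ⟦ s Sign.* t ⟧ₛ ≈ ⟦ s ⟧ₛ * ⟦ t ⟧ₛ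
  sign-homo Sign.+ t = sym (*-identityˡ _)
  sign-homo Sign.- Sign.+ = sym (*-identityʳ _)
  sign-homo Sign.- Sign.- = sym (trans (-1*x≈-x (- 1#)) (-‿involutive 1#))

  *-homo : ∀ i j → ⟦ i ℤ.* j ⟧ℤ ≈ ⟦ i ⟧ℤ * ⟦ j ⟧ℤ
  *-homo i j = begin
    ⟦ sign i Sign.* sign j ◃ ∣ i ∣ ℕ.* ∣ j ∣ ⟧ℤ
      ≈⟨ ◃-homo (sign i Sign.* sign j) (∣ i ∣ ℕ.* ∣ j ∣) ⟩
    ⟦ sign i Sign.* sign j ⟧ₛ * ((∣ i ∣ ℕ.* ∣ j ∣) · 1#)
      ≈⟨ *-cong (sign-homo (sign i) (sign j)) (×1-homo-* ∣ i ∣ ∣ j ∣) ⟩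
    (⟦ sign i ⟧ₛ * ⟦ sign j ⟧ₛ) * (∣ i ∣ · 1# * ∣ j ∣ · 1#)
      ≈⟨ *-interchange _ _ _ _ ⟩
    (⟦ sign i ⟧ₛ * ∣ i ∣ · 1#) * (⟦ sign j ⟧ₛ * ∣ j ∣ · 1#)
      ≈⟨ *-cong (◃-homo (sign i) ∣ i ∣) (◃-homo (sign j) ∣ j ∣) ⟨
    ⟦ sign i ◃ ∣ i ∣ ⟧ℤ * ⟦ sign j ◃ ∣ j ∣ ⟧ℤ
      ≡⟨ ≡.cong₂ (λ i j → ⟦ i ⟧ℤ * ⟦ j ⟧ℤ) (ℤ.◃-inverse i) (ℤ.◃-inverse j) ⟩
    ⟦ i ⟧ℤ * ⟦ j ⟧ℤ ∎

  homomorphism : ℤ.+-*-rawRing -Raw-AlmostCommutative⟶ fromCommutativeRing R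
  homomorphism = record
    { ⟦_⟧ = ⟦_⟧ℤ ; +-homo = +-homo ; *-homo = *-homo ; -‿homo = -‿homo
    ; 0-homo = refl ; 1-homo = refl }

  ⟦⟧ℤ-≟ : WeaklyDecidable (Induced-equivalence homomorphism)
  ⟦⟧ℤ-≟ i j with i ℤ.≟ j
  ... | yes ≡.refl = just refl
  ... | no _ = nothing

  open import Algebra.Solver.Ring ℤ.+-*-rawRing (fromCommutativeRing R) homomorphism ⟦⟧ℤ-≟ public

  :0 :1 : ∀ {n} → Polynomial n
  :0 = con (+ 0)
  :1 = con (+ 1)

module FiniteSums {c ℓ} (R : CommutativeRing c ℓ) where
  open CommutativeRing R
  open import Relation.Binary.Reasoning.Setoid setoid

  ∑ : {A : Set} → List A → (A → Carrier) → Carrier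
  ∑ xs f = sumR R (map f xs)

  infix 5 ∑
  syntax ∑ xs (λ x → e) = ∑[ x ∈ xs ] e

  infixr 8 _◂_
  _◂_ : Bool → Carrier → Carrier
  b ◂ x = if b then x else 0#

  ◂-cong : ∀ b {x y} → x ≈ y → b ◂ x ≈ b ◂ y
  ◂-cong true x≈y = x≈y
  ◂-cong false _ = refl

  ◂-zero : ∀ b → b ◂ 0# ≈ 0#
  ◂-zero true = refl
  ◂-zero false = refl

  *-◂ : ∀ x b y → x * (b ◂ y) ≈ b ◂ (x * y)
  *-◂ x true y = refl
  *-◂ x false y = zeroʳ x

  ∧-◂-* : ∀ b b′ x y → (b ∧ b′) ◂ (x * y) ≈ (b ◂ x) * (b′ ◂ y)
  ∧-◂-* true true x y = refl
  ∧-◂-* true false x y = sym (zeroʳ x)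
  ∧-◂-* false b′ x y = sym (zeroˡ _)

  module _ {A : Set} where

    ∑-congᴬ : ∀ {f g : A → Carrier} {xs} → All (λ x → f x ≈ g x) xs → ∑ xs f ≈ ∑ xs g
    ∑-congᴬ [] = refl
    ∑-congᴬ (fx≈gx ∷ eqs) = +-cong fx≈gx (∑-congᴬ eqs)

    ∑-cong : ∀ {f g : A → Carrier} xs → (∀ x → f x ≈ g x) → ∑ xs f ≈ ∑ xs g
    ∑-cong xs f≈g = ∑-congᴬ (All.universal f≈g xs)

    ∑-zero : ∀ {f : A → Carrier} xs → (∀ x → f x ≈ 0#) → ∑ xs f ≈ 0#
    ∑-zero [] _ = refl
    ∑-zero (x ∷ xs) f≈0 = trans (+-cong (f≈0 x) (∑-zero xs f≈0)) (+-identityʳ 0#)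

    *-distribˡ-∑ : ∀ y (f : A → Carrier) xs → y * (∑[ x ∈ xs ] f x) ≈ ∑[ x ∈ xs ] y * f x
    *-distribˡ-∑ y f [] = zeroʳ y
    *-distribˡ-∑ y f (x ∷ xs) = trans (distribˡ y _ _) (+-congˡ (*-distribˡ-∑ y f xs))

    ∑-++ : ∀ (f : A → Carrier) xs ys → ∑ (xs ++ ys) f ≈ ∑ xs f + ∑ ys f
    ∑-++ f [] ys = sym (+-identityˡ _)
    ∑-++ f (x ∷ xs) ys = trans (+-congˡ (∑-++ f xs ys)) (sym (+-assoc _ _ _))

    ∑-concatMap : ∀ {B : Set} (f : A → Carrier) (g : B → List A) xs →
                  ∑[ y ∈ concatMap g xs ] f y ≈ ∑[ x ∈ xs ] ∑[ y ∈ g x ] f y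
    ∑-concatMap f g [] = refl
    ∑-concatMap f g (x ∷ xs) = trans (∑-++ f (g x) (concatMap g xs)) (+-congˡ (∑-concatMap f g xs))

    ∑-filter : ∀ {P : A → Set} (P? : Decidable P) (f : A → Carrier) xs →
               ∑[ x ∈ filter P? xs ] f x ≈ ∑[ x ∈ xs ] does (P? x) ◂ f x
    ∑-filter P? f [] = refl
    ∑-filter P? f (x ∷ xs) with does (P? x)
    ... | true = +-congˡ (∑-filter P? f xs)
    ... | false = trans (∑-filter P? f xs) (sym (+-identityˡ _))

    ∑-+ : ∀ (f g : A → Carrier) xs → ∑[ x ∈ xs ] (f x + g x) ≈ ∑ xs f + ∑ xs g
    ∑-+ f g [] = sym (+-identityʳ 0#)
    ∑-+ f g (x ∷ xs) = trans (+-congˡ (∑-+ f g xs)) (interchange _ _ _ _)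
      where open import Algebra.Properties.CommutativeSemigroup +-commutativeSemigroup using (interchange)

  ∑-upTo-suc : ∀ (f : ℕ → Carrier) n → ∑[ i ∈ upTo (suc n) ] f i ≡ f 0 + (∑[ i ∈ upTo n ] f (suc i))
  ∑-upTo-suc f n = ≡.cong (sumR R)
    (≡.trans (List.map-upTo f (suc n)) (≡.cong (f 0 ∷_) (≡.sym (List.map-upTo (f ∘ suc) n))))

module PowerSeries {c ℓ} (R : CommutativeRing c ℓ) where
  open CommutativeRing R
  open FiniteSums R
  open IntegerCoefficients R using (solve; _:=_; _:+_; _:*_)
  open import Relation.Binary.Reasoning.Setoid setoid

  infix 4 _≋_
  _≋_ : Series R → Series R → Set ℓ
  f ≋ g = ∀ n → f n ≈ g n

  tail : Series R → Series R
  tail f n = f (suc n)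

  scale : Carrier → Series R → Series R
  scale x f n = x * f n

  zeroS : Series R
  zeroS _ = 0#

  mulS-zero : ∀ f g → mulS R f g 0 ≈ f 0 * g 0
  mulS-zero f g = +-identityʳ (f 0 * g 0)

  mulS-suc : ∀ f g n → mulS R f g (suc n) ≡ f 0 * g (suc n) + mulS R (tail f) g n
  mulS-suc f g n = ∑-upTo-suc (λ i → f i * g (suc n ∸ i)) (suc n)

  mulS-cong : ∀ {f f′ g g′} → f ≋ f′ → g ≋ g′ → mulS R f g ≋ mulS R f′ g′
  mulS-cong {f} {f′} {g} {g′} f≋f′ g≋g′ n =
    ∑-cong {f = λ i → f i * g (n ∸ i)} {g = λ i → f′ i * g′ (n ∸ i)} (upTo (suc n))
           (λ i → *-cong (f≋f′ i) (g≋g′ (n ∸ i)))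

  mulS-last : ∀ f g n → mulS R f g (suc n) ≈ mulS R f (tail g) n + f (suc n) * g 0
  mulS-last f g zero = begin
    mulS R f g 1                          ≡⟨ mulS-suc f g 0 ⟩
    f 0 * g 1 + mulS R (tail f) g 0       ≈⟨ +-congˡ (mulS-zero (tail f) g) ⟩
    f 0 * g 1 + f 1 * g 0                 ≈⟨ +-congʳ (mulS-zero f (tail g)) ⟨
    mulS R f (tail g) 0 + f 1 * g 0       ∎
  mulS-last f g (suc n) = begin
    mulS R f g (2 ℕ.+ n)                                          ≡⟨ mulS-suc f g (suc n) ⟩
    f 0 * g (2 ℕ.+ n) + mulS R (tail f) g (suc n)                 ≈⟨ +-congˡ (mulS-last (tail f) g n) ⟩
    f 0 * g (2 ℕ.+ n) + (mulS R (tail f) (tail g) n + f (2 ℕ.+ n) * g 0) ≈⟨ +-assoc _ _ _ ⟨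
    f 0 * g (2 ℕ.+ n) + mulS R (tail f) (tail g) n + f (2 ℕ.+ n) * g 0   ≡⟨ ≡.cong (_+ _) (mulS-suc f (tail g) n) ⟨
    mulS R f (tail g) (suc n) + f (2 ℕ.+ n) * g 0                 ∎

  mulS-comm : ∀ f g → mulS R f g ≋ mulS R g f
  mulS-comm f g zero = trans (mulS-zero f g) (trans (*-comm _ _) (sym (mulS-zero g f)))
  mulS-comm f g (suc n) = begin
    mulS R f g (suc n)                   ≡⟨ mulS-suc f g n ⟩
    f 0 * g (suc n) + mulS R (tail f) g n ≈⟨ +-cong (*-comm _ _) (mulS-comm (tail f) g n) ⟩
    g (suc n) * f 0 + mulS R g (tail f) n ≈⟨ +-comm _ _ ⟩
    mulS R g (tail f) n + g (suc n) * f 0 ≈⟨ mulS-last g f n ⟨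
    mulS R g f (suc n)                   ∎

  mulS-distribˡ : ∀ f g h → mulS R f (addS R g h) ≋ addS R (mulS R f g) (mulS R f h)
  mulS-distribˡ f g h n =
    trans (∑-cong {f = λ i → f i * (g (n ∸ i) + h (n ∸ i))} (upTo (suc n)) (λ i → distribˡ (f i) _ _))
          (∑-+ (λ i → f i * g (n ∸ i)) (λ i → f i * h (n ∸ i)) (upTo (suc n)))

  mulS-distribʳ : ∀ f g h → mulS R (addS R g h) f ≋ addS R (mulS R g f) (mulS R h f)
  mulS-distribʳ f g h n = begin
    mulS R (addS R g h) f n           ≈⟨ mulS-comm (addS R g h) f n ⟩
    mulS R f (addS R g h) n           ≈⟨ mulS-distribˡ f g h n ⟩
    mulS R f g n + mulS R f h n       ≈⟨ +-cong (mulS-comm f g n) (mulS-comm f h n) ⟩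
    mulS R g f n + mulS R h f n       ∎

  mulS-scale : ∀ x f g → mulS R (scale x f) g ≋ scale x (mulS R f g)
  mulS-scale x f g n =
    trans (∑-cong {f = λ i → x * f i * g (n ∸ i)} (upTo (suc n)) (λ i → *-assoc x (f i) _))
          (sym (*-distribˡ-∑ x (λ i → f i * g (n ∸ i)) (upTo (suc n))))

  tail-mulS : ∀ f g → tail (mulS R f g) ≋ addS R (scale (f 0) (tail g)) (mulS R (tail f) g)
  tail-mulS f g n = reflexive (mulS-suc f g n)

  mulS-assoc : ∀ f g h → mulS R (mulS R f g) h ≋ mulS R f (mulS R g h)
  mulS-assoc f g h zero = begin
    mulS R (mulS R f g) h 0   ≈⟨ trans (mulS-zero (mulS R f g) h) (*-congʳ (mulS-zero f g)) ⟩
    (f 0 * g 0) * h 0         ≈⟨ *-assoc _ _ _ ⟩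
    f 0 * (g 0 * h 0)         ≈⟨ trans (mulS-zero f (mulS R g h)) (*-congˡ (mulS-zero g h)) ⟨
    mulS R f (mulS R g h) 0   ∎
  mulS-assoc f g h (suc n) = begin
    mulS R (mulS R f g) h (suc n)
      ≡⟨ mulS-suc (mulS R f g) h n ⟩
    mulS R f g 0 * h (suc n) + mulS R (tail (mulS R f g)) h n
      ≈⟨ +-cong (*-congʳ (mulS-zero f g)) (mulS-cong {g = h} (tail-mulS f g) (λ _ → refl) n) ⟩
    (f 0 * g 0) * h (suc n) + mulS R (addS R (scale (f 0) (tail g)) (mulS R (tail f) g)) h n
      ≈⟨ +-congˡ (mulS-distribʳ h (scale (f 0) (tail g)) (mulS R (tail f) g) n) ⟩
    (f 0 * g 0) * h (suc n) + (mulS R (scale (f 0) (tail g)) h n + mulS R (mulS R (tail f) g) h n)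
      ≈⟨ +-congˡ (+-cong (mulS-scale (f 0) (tail g) h n) (mulS-assoc (tail f) g h n)) ⟩
    (f 0 * g 0) * h (suc n) + (f 0 * mulS R (tail g) h n + mulS R (tail f) (mulS R g h) n)
      ≈⟨ solve 5 (λ a b c d e → a :* b :* c :+ (a :* d :+ e) := a :* (b :* c :+ d) :+ e) refl
           (f 0) (g 0) (h (suc n)) (mulS R (tail g) h n) (mulS R (tail f) (mulS R g h) n) ⟩
    f 0 * (g 0 * h (suc n) + mulS R (tail g) h n) + mulS R (tail f) (mulS R g h) n
      ≡⟨ ≡.cong (λ t → f 0 * t + mulS R (tail f) (mulS R g h) n) (mulS-suc g h n) ⟨
    f 0 * mulS R g h (suc n) + mulS R (tail f) (mulS R g h) n
      ≡⟨ mulS-suc f (mulS R g h) n ⟨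
    mulS R f (mulS R g h) (suc n) ∎

  mulS-zeroˡ : ∀ f → mulS R zeroS f ≋ zeroS
  mulS-zeroˡ f n = ∑-zero {f = λ i → 0# * f (n ∸ i)} (upTo (suc n)) (λ i → zeroˡ _)

  mulS-identityˡ : ∀ f → mulS R (oneS R) f ≋ f
  mulS-identityˡ f zero = trans (mulS-zero (oneS R) f) (*-identityˡ _)
  mulS-identityˡ f (suc n) = begin
    mulS R (oneS R) f (suc n)               ≡⟨ mulS-suc (oneS R) f n ⟩
    1# * f (suc n) + mulS R zeroS f n       ≈⟨ +-cong (*-identityˡ _) (mulS-zeroˡ f n) ⟩
    f (suc n) + 0#                          ≈⟨ +-identityʳ _ ⟩
    f (suc n)                               ∎

  +-isAbelianGroupˢ : IsAbelianGroup _≋_ (addS R) zeroS (negS R)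
  +-isAbelianGroupˢ = Pointwise.isAbelianGroup ℕ +-isAbelianGroup

  open IsAbelianGroup +-isAbelianGroupˢ using () renaming (setoid to ≋-setoid; ∙-cong to addS-cong)

  seriesRing : CommutativeRing c ℓ
  seriesRing = record
    { Carrier = Series R ; _≈_ = _≋_ ; _+_ = addS R ; _*_ = mulS R ; -_ = negS R
    ; 0# = zeroS ; 1# = oneS R
    ; isCommutativeRing = record
      { isRing = record
        { +-isAbelianGroup = +-isAbelianGroupˢ
        ; *-cong = mulS-cong
        ; *-assoc = mulS-assoc
        ; *-identity = comm∧idˡ⇒id ≋-setoid mulS-comm mulS-identityˡ
        ; distrib = comm∧distrˡ⇒distr ≋-setoid addS-cong mulS-comm mulS-distribˡ
        }
      ; *-comm = mulS-comm
      }
    }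

  monomial₁ : Carrier → Series R
  monomial₁ x zero = 0#
  monomial₁ x (suc zero) = x
  monomial₁ x (suc (suc _)) = 0#

  mulS-monomial₁-zero : ∀ x f → mulS R (monomial₁ x) f 0 ≈ 0#
  mulS-monomial₁-zero x f = trans (mulS-zero (monomial₁ x) f) (zeroˡ (f 0))

  mulS-monomial₁-suc : ∀ x f n → mulS R (monomial₁ x) f (suc n) ≈ x * f n
  mulS-monomial₁-suc x f n = begin
    mulS R (monomial₁ x) f (suc n)                     ≡⟨ mulS-suc (monomial₁ x) f n ⟩
    0# * f (suc n) + mulS R (tail (monomial₁ x)) f n   ≈⟨ +-cong (zeroˡ _) (tail-monomial₁ n) ⟩
    0# + x * f n                                       ≈⟨ +-identityˡ _ ⟩
    x * f n                                            ∎
    where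
    tail-monomial₁ : ∀ n → mulS R (tail (monomial₁ x)) f n ≈ x * f n
    tail-monomial₁ zero = mulS-zero (tail (monomial₁ x)) f
    tail-monomial₁ (suc n) = begin
      mulS R (tail (monomial₁ x)) f (suc n)   ≡⟨ mulS-suc (tail (monomial₁ x)) f n ⟩
      x * f (suc n) + mulS R zeroS f n        ≈⟨ +-congˡ (mulS-zeroˡ f n) ⟩
      x * f (suc n) + 0#                      ≈⟨ +-identityʳ _ ⟩
      x * f (suc n)                           ∎


module Transfer {c ℓ} (R : CommutativeRing c ℓ) (V : ℕ → CommutativeRing.Carrier R) (K : ℕ) where
  open CommutativeRing R
  open FiniteSums R
  open IntegerCoefficients R using (solve; _:=_; _:*_; :-_)
  open import Algebra.Properties.Ring ring using (-‿distribˡ-*)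
  open import Relation.Binary.Reasoning.Setoid setoid

  edge : ℕ → ℕ → Carrier
  edge p a = compatible p a ◂ - V a

  transfer : ℕ → Series R
  transfer p zero = compatible p 0 ◂ 1#
  transfer p (suc n) = ∑[ a ∈ upTo (suc K) ] edge p a * transfer a n

  ∑-allSeqs-suc : ∀ n (h : List ℕ → Carrier) →
                  ∑[ as ∈ allSeqs K (suc n) ] h as ≈ ∑[ a ∈ upTo (suc K) ] ∑[ as ∈ allSeqs K n ] h (a ∷ as)
  ∑-allSeqs-suc n h = trans (∑-concatMap h (λ a → map (a ∷_) (allSeqs K n)) (upTo (suc K)))
    (∑-cong (upTo (suc K)) (λ a → reflexive (≡.cong (sumR R) (≡.sym (List.map-∘ (allSeqs K n))))))

  transfer-counts : ∀ p n → ∑[ as ∈ allSeqs K n ] chain p as ◂ (signR R n * wt R V as) ≈ transfer p n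
  transfer-counts p zero = trans (+-identityʳ _) (◂-cong (compatible p 0) (*-identityˡ 1#))
  transfer-counts p (suc n) = begin
    ∑[ as ∈ allSeqs K (suc n) ] chain p as ◂ (signR R (suc n) * wt R V as)
      ≈⟨ ∑-allSeqs-suc n (λ as → chain p as ◂ (signR R (suc n) * wt R V as)) ⟩
    ∑[ a ∈ upTo (suc K) ] ∑[ as ∈ allSeqs K n ] (compatible p a ∧ chain a as) ◂ (- signR R n * (V a * wt R V as))
      ≈⟨ ∑-cong (upTo (suc K)) (λ a → ∑-cong (allSeqs K n) (λ as → first-step a as)) ⟩
    ∑[ a ∈ upTo (suc K) ] ∑[ as ∈ allSeqs K n ] edge p a * (chain a as ◂ (signR R n * wt R V as))
      ≈⟨ ∑-cong (upTo (suc K)) (λ a →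
           sym (*-distribˡ-∑ (edge p a) (λ as → chain a as ◂ (signR R n * wt R V as)) (allSeqs K n))) ⟩
    ∑[ a ∈ upTo (suc K) ] edge p a * (∑[ as ∈ allSeqs K n ] chain a as ◂ (signR R n * wt R V as))
      ≈⟨ ∑-cong (upTo (suc K)) (λ a → *-congˡ (transfer-counts a n)) ⟩
    transfer p (suc n) ∎
    where
    first-step : ∀ a as → (compatible p a ∧ chain a as) ◂ (- signR R n * (V a * wt R V as))
                          ≈ edge p a * (chain a as ◂ (signR R n * wt R V as))
    first-step a as = trans
      (◂-cong (compatible p a ∧ chain a as)
        (solve 3 (λ s v w → :- s :* (v :* w) := :- v :* (s :* w)) refl (signR R n) (V a) (wt R V as)))
      (∧-◂-* (compatible p a) (chain a as) (- V a) _)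

  lhsSeries≈-transfer : ∀ n → lhsSeries R V K n ≈ - transfer 0 n
  lhsSeries≈-transfer n = begin
    - signR R n * (∑[ as ∈ ModPV K n ] wt R V as)
      ≈⟨ *-congˡ (∑-filter (isModPV? K) (wt R V) (allSeqs K n)) ⟩
    - signR R n * (∑[ as ∈ allSeqs K n ] does (isModPV? K as) ◂ wt R V as)
      ≈⟨ *-congˡ (∑-congᴬ (All.map (λ {as} bounded → reflexive (≡.cong (_◂ wt R V as) (does-isModPV K as bounded)))
                                   (allSeqs-bounded K n))) ⟩
    - signR R n * (∑[ as ∈ allSeqs K n ] chain 0 as ◂ wt R V as)
      ≈⟨ -‿distribˡ-* _ _ ⟨
    - (signR R n * (∑[ as ∈ allSeqs K n ] chain 0 as ◂ wt R V as))
      ≈⟨ -‿cong (*-distribˡ-∑ (signR R n) (λ as → chain 0 as ◂ wt R V as) (allSeqs K n)) ⟩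
    - (∑[ as ∈ allSeqs K n ] signR R n * (chain 0 as ◂ wt R V as))
      ≈⟨ -‿cong (∑-cong (allSeqs K n) (λ as → *-◂ (signR R n) (chain 0 as) (wt R V as))) ⟩
    - (∑[ as ∈ allSeqs K n ] chain 0 as ◂ (signR R n * wt R V as))
      ≈⟨ -‿cong (transfer-counts 0 n) ⟩
    - transfer 0 n ∎

module LinearSystems {c ℓ} (R : CommutativeRing c ℓ) where
  private module ℛ = CommutativeRing R
  private module ℛ∑ = FiniteSums R
  open PowerSeries R using (seriesRing; monomial₁; mulS-monomial₁-zero; mulS-monomial₁-suc)
  open CommutativeRing seriesRing
  open FiniteSums seriesRing
  open import Algebra.Properties.CommutativeSemigroup *-commutativeSemigroup using (x∙yz≈y∙xz)
  open import Relation.Binary.Reasoning.Setoid setoid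

  ◂-coeff : ∀ b f n → (b ◂ f) n ≡ b ℛ∑.◂ f n
  ◂-coeff true f n = ≡.refl
  ◂-coeff false f n = ≡.refl

  ∑-coeff : ∀ {A : Set} xs (F : A → Series R) n → (∑[ x ∈ xs ] F x) n ≡ ℛ∑.∑ xs (λ x → F x n)
  ∑-coeff [] F n = ≡.refl
  ∑-coeff (x ∷ xs) F n = ≡.cong (F x n ℛ.+_) (∑-coeff xs F n)

  xStep : (ℕ → Bool) → (ℕ → ℛ.Carrier) → (ℕ → Series R) → ℕ → Series R
  xStep M v F m = ∑[ a ∈ upTo m ] (M a ◂ monomial₁ (v a)) * F a

  private
    term-coeff-zero : ∀ b x f → ((b ◂ monomial₁ x) * f) 0 ℛ.≈ ℛ.0#
    term-coeff-zero true x f = mulS-monomial₁-zero x f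
    term-coeff-zero false x f = zeroˡ f 0

    term-coeff-suc : ∀ b x f n → ((b ◂ monomial₁ x) * f) (suc n) ℛ.≈ (b ℛ∑.◂ x) ℛ.* f n
    term-coeff-suc true x f n = mulS-monomial₁-suc x f n
    term-coeff-suc false x f n = ℛ.trans (zeroˡ f (suc n)) (ℛ.sym (ℛ.zeroˡ (f n)))

  xStep-coeff-zero : ∀ M v F m → xStep M v F m 0 ℛ.≈ ℛ.0#
  xStep-coeff-zero M v F m = ℛ.trans (ℛ.reflexive (∑-coeff (upTo m) _ 0))
    (ℛ∑.∑-zero (upTo m) (λ a → term-coeff-zero (M a) (v a) (F a)))

  xStep-coeff-suc : ∀ M v F m n →
                    xStep M v F m (suc n) ℛ.≈ ℛ∑.∑ (upTo m) (λ a → (M a ℛ∑.◂ v a) ℛ.* F a n)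
  xStep-coeff-suc M v F m n = ℛ.trans (ℛ.reflexive (∑-coeff (upTo m) _ (suc n)))
    (ℛ∑.∑-cong (upTo m) (λ a → term-coeff-suc (M a) (v a) (F a) n))

  -- Every entry of the matrix is divisible by x, so each coefficient of a solution is determined
  -- by the lower ones.
  xStep-unique : ∀ {M : ℕ → ℕ → Bool} {v m} {C F G : ℕ → Series R} →
                 (∀ p → F p ≈ C p + xStep (M p) v F m) → (∀ p → G p ≈ C p + xStep (M p) v G m) →
                 ∀ p → F p ≈ G p
  xStep-unique {M} {v} {m} {C} {F} {G} F-eq G-eq p n =
    ℛ.trans (F-eq p n) (ℛ.trans (ℛ.+-congˡ (steps-agree n)) (ℛ.sym (G-eq p n)))
    where
    steps-agree : ∀ n → xStep (M p) v F m n ℛ.≈ xStep (M p) v G m n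
    steps-agree zero = ℛ.trans (xStep-coeff-zero (M p) v F m) (ℛ.sym (xStep-coeff-zero (M p) v G m))
    steps-agree (suc n) = ℛ.trans (xStep-coeff-suc (M p) v F m n) (ℛ.trans
      (ℛ∑.∑-cong (upTo m) (λ a → ℛ.*-congˡ (xStep-unique {M} {v} {m} F-eq G-eq a n)))
      (ℛ.sym (xStep-coeff-suc (M p) v G m n)))

  xStep-cong : ∀ M v {F G} m → (∀ a → F a ≈ G a) → xStep M v F m ≈ xStep M v G m
  xStep-cong M v m F≈G = ∑-cong (upTo m) (λ a → *-congˡ (F≈G a))

  xStep-row-cong : ∀ {M M′} v F m → (∀ a → M a ≡ M′ a) → xStep M v F m ≈ xStep M′ v F m
  xStep-row-cong v F m M≡M′ =
    ∑-cong (upTo m) (λ a → *-congʳ (reflexive (≡.cong (_◂ monomial₁ (v a)) (M≡M′ a))))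

  xStep-scale : ∀ Z M v F m → Z * xStep M v F m ≈ xStep M v (λ a → Z * F a) m
  xStep-scale Z M v F m = trans (*-distribˡ-∑ Z (λ a → (M a ◂ monomial₁ (v a)) * F a) (upTo m))
    (∑-cong (upTo m) (λ a → x∙yz≈y∙xz Z _ (F a)))

  xStep-none : ∀ v F m → xStep (λ _ → false) v F m ≈ 0#
  xStep-none v F m = ∑-zero (upTo m) (λ a → zeroˡ (F a))

  xStep-split₃ : ∀ M v F m → xStep M v F (3 ℕ.+ m) ≡
    (M 0 ◂ monomial₁ (v 0)) * F 0 + ((M 1 ◂ monomial₁ (v 1)) * F 1 + ((M 2 ◂ monomial₁ (v 2)) * F 2 +
      xStep (λ a → M (3 ℕ.+ a)) (λ a → v (3 ℕ.+ a)) (λ a → F (3 ℕ.+ a)) m))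
  xStep-split₃ M v F m =
    ≡.trans (∑-upTo-suc t (2 ℕ.+ m)) (≡.cong (λ s → t 0 + s)
      (≡.trans (∑-upTo-suc (t ∘ suc) (suc m)) (≡.cong (λ s → t 1 + s) (∑-upTo-suc (t ∘ suc ∘ suc) m))))
    where
    t : ℕ → Series R
    t a = (M a ◂ monomial₁ (v a)) * F a

module TransferEquation {c ℓ} (R : CommutativeRing c ℓ) (V : ℕ → CommutativeRing.Carrier R) (K : ℕ) where
  private module ℛ = CommutativeRing R
  private module ℛ∑ = FiniteSums R
  open Transfer R V K using (transfer)
  open PowerSeries R using (seriesRing)
  open LinearSystems R
  open CommutativeRing seriesRing
  open FiniteSums seriesRing using (_◂_)

  negV : ℕ → ℛ.Carrier
  negV a = ℛ.- V a

  transfer-equation : ∀ p → transfer p ≈ (compatible p 0 ◂ 1#) + xStep (compatible p) negV transfer (suc K)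
  transfer-equation p zero = ℛ.sym (ℛ.trans
    (ℛ.+-cong (ℛ.reflexive (◂-coeff (compatible p 0) 1# 0)) (xStep-coeff-zero (compatible p) negV transfer (suc K)))
    (ℛ.+-identityʳ _))
  transfer-equation p (suc n) = ℛ.sym (ℛ.trans
    (ℛ.+-cong (ℛ.reflexive (◂-coeff (compatible p 0) 1# (suc n))) (xStep-coeff-suc (compatible p) negV transfer (suc K) n))
    (ℛ.trans (ℛ.+-congʳ (ℛ∑.◂-zero (compatible p 0))) (ℛ.+-identityˡ _)))

module ContinuantIdentities {c ℓ} (R : CommutativeRing c ℓ) where
  open CommutativeRing R
  open IntegerCoefficients R using (solve; _:=_; _:+_; _:*_; :-_; _:-_; :0; :1)
  open import Relation.Binary.Reasoning.Setoid setoid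

  one-level : ∀ {b U g} → b ≈ U - 1# → g ≈ 1# + (U * g + 0#) → b * - g ≈ 1#
  one-level {b} {U} {g} b≈ g≈ = begin
    b * - g                  ≈⟨ *-congʳ b≈ ⟩
    (U - 1#) * - g           ≈⟨ solve 2 (λ u x → (u :- :1) :* (:- x) := x :- u :* x) refl U g ⟩
    g - U * g                ≈⟨ +-congʳ g≈ ⟩
    1# + (U * g + 0#) - U * g ≈⟨ solve 2 (λ u x → :1 :+ (u :* x :+ :0) :- u :* x := :1) refl U g ⟩
    1# ∎

  three-levels : ∀ {b₀ b₁ b₂ U₀ U₁ U₂ g₀ g₁ g₂ T q p} →
    b₀ ≈ U₀ - 1# → b₁ ≈ U₁ - 1# → b₂ ≈ U₂ - 1# →
    g₀ ≈ 1# + U₀ * g₀ + g₁ → g₁ ≈ g₂ * (U₂ + T - 1#) → g₂ ≈ 1# + U₀ * g₀ + U₁ * g₁ →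
    q * - T ≈ p →
    (b₀ * (b₁ * (b₂ * q - p) - q) - (b₂ * q - p)) * - g₀ ≈ b₁ * (b₂ * q - p) - q
  three-levels {b₀} {b₁} {b₂} {U₀} {U₁} {U₂} {g₀} {g₁} {g₂} {T} {q} {p} b₀≈ b₁≈ b₂≈ g₀≈ g₁≈ g₂≈ p≈ = begin
    (b₀ * X₁ - X₂) * - g₀
      ≈⟨ *-congʳ (+-cong (*-cong b₀≈ X₁≈) (-‿cong X₂≈)) ⟩
    ((U₀ - 1#) * - (q * Q) - q * P) * - g₀
      ≈⟨ solve 5 (λ u x y z g → ((u :- :1) :* (:- (x :* y)) :- x :* z) :* (:- g)
                                := :- (x :* (g :* ((:1 :- u) :* y :- z)))) refl U₀ q Q P g₀ ⟩
    - (q * (g₀ * ((1# - U₀) * Q - P)))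
      ≈⟨ -‿cong (*-congˡ key) ⟩
    - (q * Q)
      ≈⟨ X₁≈ ⟨
    X₁ ∎
    where
    P Q X₁ X₂ : Carrier
    P = U₂ + T - 1#
    Q = 1# + P - U₁ * P
    X₂ = b₂ * q - p
    X₁ = b₁ * X₂ - q

    g₀≈g₂Q : g₀ ≈ g₂ * Q
    g₀≈g₂Q = sym (begin
      g₂ * Q
        ≈⟨ solve 3 (λ x y u → x :* (:1 :+ y :- u :* y) := x :+ x :* y :- u :* (x :* y)) refl g₂ P U₁ ⟩
      g₂ + g₂ * P - U₁ * (g₂ * P)
        ≈⟨ +-cong (+-cong g₂≈ (sym g₁≈)) (-‿cong (*-congˡ (sym g₁≈))) ⟩
      1# + U₀ * g₀ + U₁ * g₁ + g₁ - U₁ * g₁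
        ≈⟨ solve 4 (λ u x v y → :1 :+ u :* x :+ v :* y :+ y :- v :* y := :1 :+ u :* x :+ y) refl U₀ g₀ U₁ g₁ ⟩
      1# + U₀ * g₀ + g₁
        ≈⟨ g₀≈ ⟨
      g₀ ∎)

    key : g₀ * ((1# - U₀) * Q - P) ≈ Q
    key = begin
      g₀ * ((1# - U₀) * Q - P)
        ≈⟨ solve 4 (λ x u y z → x :* ((:1 :- u) :* y :- z) := (x :- u :* x) :* y :- x :* z) refl g₀ U₀ Q P ⟩
      (g₀ - U₀ * g₀) * Q - g₀ * P
        ≈⟨ +-cong (*-congʳ (+-congʳ g₀≈)) (-‿cong (*-congʳ g₀≈g₂Q)) ⟩
      (1# + U₀ * g₀ + g₁ - U₀ * g₀) * Q - g₂ * Q * P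
        ≈⟨ +-congʳ (*-congʳ (+-congʳ (+-congˡ g₁≈))) ⟩
      (1# + U₀ * g₀ + g₂ * P - U₀ * g₀) * Q - g₂ * Q * P
        ≈⟨ solve 5 (λ u x y z w → (:1 :+ u :* x :+ y :* z :- u :* x) :* w :- y :* w :* z := w) refl U₀ g₀ g₂ P Q ⟩
      Q ∎

    X₂≈ : X₂ ≈ q * P
    X₂≈ = begin
      b₂ * q - p
        ≈⟨ +-cong (*-congʳ b₂≈) (-‿cong (sym p≈)) ⟩
      (U₂ - 1#) * q - q * - T
        ≈⟨ solve 3 (λ u x t → (u :- :1) :* x :- x :* (:- t) := x :* (u :+ t :- :1)) refl U₂ q T ⟩
      q * P ∎

    X₁≈ : X₁ ≈ - (q * Q)
    X₁≈ = begin
      b₁ * X₂ - q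
        ≈⟨ +-congʳ (*-cong b₁≈ X₂≈) ⟩
      (U₁ - 1#) * (q * P) - q
        ≈⟨ solve 3 (λ u x y → (u :- :1) :* (x :* y) :- x := :- (x :* (:1 :+ y :- u :* y))) refl U₁ q P ⟩
      - (q * Q) ∎

module ContinuedFractions {c ℓ} (R : CommutativeRing c ℓ) where
  private module ℛ = CommutativeRing R
  open PowerSeries R using (seriesRing; monomial₁)
  open CommutativeRing seriesRing
  open import Algebra.Properties.Ring ℛ.ring using (-0#≈0#)

  CFIdentity : (ℕ → ℛ.Carrier) → ℕ → Set ℓ
  CFIdentity V K = cfDen R V 0 K * lhsSeries R V K ≈ cfNum R V 0 K

  partialDen≋ : ∀ V j → partialDen R V j ≈ monomial₁ (ℛ.- V j) - 1#
  partialDen≋ V j zero = ℛ.sym (ℛ.+-identityˡ _)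
  partialDen≋ V j (suc zero) = ℛ.sym (ℛ.trans (ℛ.+-congˡ -0#≈0#) (ℛ.+-identityʳ _))
  partialDen≋ V j (suc (suc n)) = ℛ.sym (ℛ.trans (ℛ.+-congˡ -0#≈0#) (ℛ.+-identityʳ _))

  partialDen-suc : ∀ V j → partialDen R V (suc j) ≈ partialDen R (V ∘ suc) j
  partialDen-suc V j zero = ℛ.refl
  partialDen-suc V j (suc zero) = ℛ.refl
  partialDen-suc V j (suc (suc n)) = ℛ.refl

  infix 4 _≈²_
  _≈²_ : Series R × Series R → Series R × Series R → Set ℓ
  p ≈² q = proj₁ p ≈ proj₁ q × proj₂ p ≈ proj₂ q

  CF-suc : ∀ V j m → CF R V (suc j) m ≈² CF R (V ∘ suc) j m
  CF-suc V j zero = refl , partialDen-suc V j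
  CF-suc V j (suc m) =
    let (num , den) = CF-suc V (suc j) m in den , +-cong (*-cong (partialDen-suc V j) den) (-‿cong num)

  CF-shift : ∀ i V m → CF R V i m ≈² CF R (λ a → V (i ℕ.+ a)) 0 m
  CF-shift zero V m = refl , refl
  CF-shift (suc i) V m =
    let (num₁ , den₁) = CF-suc V i m
        (num₂ , den₂) = CF-shift i (V ∘ suc) m
    in trans num₁ num₂ , trans den₁ den₂

module ThreeLevels {c ℓ} (R : CommutativeRing c ℓ) (V : ℕ → CommutativeRing.Carrier R) (K′ : ℕ) where
  private module ℛ = CommutativeRing R
  open PowerSeries R using (seriesRing; monomial₁)
  open ContinuedFractions R using (CFIdentity; partialDen≋; _≈²_; CF-shift)
  open LinearSystems R
  open CommutativeRing seriesRing
  open FiniteSums seriesRing using (_◂_)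
  open IntegerCoefficients seriesRing using (solve; _:=_; _:+_; _:*_; :-_; _:-_; :0; :1)
  open ContinuantIdentities seriesRing using (three-levels)
  open import Relation.Binary.Reasoning.Setoid setoid

  V′ : ℕ → ℛ.Carrier
  V′ a = V (3 ℕ.+ a)

  open Transfer R V (3 ℕ.+ K′) using () renaming (transfer to g; lhsSeries≈-transfer to lhs≈-g₀)
  open Transfer R V′ K′ using () renaming (transfer to h; lhsSeries≈-transfer to lhs′≈-h₀)
  open TransferEquation R V (3 ℕ.+ K′) using (negV) renaming (transfer-equation to g-equation)
  open TransferEquation R V′ K′ using () renaming (negV to negV′; transfer-equation to h-equation)

  U : ℕ → Series R
  U a = monomial₁ (ℛ.- V a)

  high : ℕ → Series R
  high a = g (3 ℕ.+ a)

  toHigh : ℕ → Series R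
  toHigh p = xStep (λ b → compatible p (3 ℕ.+ b)) negV′ high (suc K′)

  g-split : ∀ p → g p ≈ (compatible p 0 ◂ 1#) + ((compatible p 0 ◂ U 0) * g 0 + ((compatible p 1 ◂ U 1) * g 1 +
                          ((compatible p 2 ◂ U 2) * g 2 + toHigh p)))
  g-split p = trans (g-equation p) (+-congˡ (reflexive (xStep-split₃ (compatible p) negV g (suc K′))))

  g₂≈ : g 2 ≈ 1# + U 0 * g 0 + U 1 * g 1
  g₂≈ = begin
    g 2
      ≈⟨ g-split 2 ⟩
    1# + (U 0 * g 0 + (U 1 * g 1 + (0# * g 2 + toHigh 2)))
      ≈⟨ +-congˡ (+-congˡ (+-congˡ (+-congˡ (xStep-none negV′ high (suc K′))))) ⟩
    1# + (U 0 * g 0 + (U 1 * g 1 + (0# * g 2 + 0#)))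
      ≈⟨ solve 5 (λ u x v y z → :1 :+ (u :* x :+ (v :* y :+ (:0 :* z :+ :0))) := :1 :+ u :* x :+ v :* y)
                 refl (U 0) (g 0) (U 1) (g 1) (g 2) ⟩
    1# + U 0 * g 0 + U 1 * g 1 ∎

  high≈ : ∀ a → high a ≈ (compatible a 0 ◂ 1#) * g 2 + xStep (compatible a) negV′ high (suc K′)
  high≈ a = trans (g-split (3 ℕ.+ a))
    (trans (absorb (compatible-high-0 a) (compatible-high-1 a) (compatible-high-2 a))
           (+-congˡ (xStep-row-cong negV′ high (suc K′) (compatible-shift a))))
    where
    absorb : ∀ {e₀ e₁ e₂ e X} → e₀ ≡ e → e₁ ≡ e → e₂ ≡ false →
             (e₀ ◂ 1#) + ((e₀ ◂ U 0) * g 0 + ((e₁ ◂ U 1) * g 1 + ((e₂ ◂ U 2) * g 2 + X)))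
             ≈ (e ◂ 1#) * g 2 + X
    absorb {e = true} {X} ≡.refl ≡.refl ≡.refl = begin
      1# + (U 0 * g 0 + (U 1 * g 1 + (0# * g 2 + X)))
        ≈⟨ solve 6 (λ u x v y z w → :1 :+ (u :* x :+ (v :* y :+ (:0 :* z :+ w))) := (:1 :+ u :* x :+ v :* y) :+ w)
                   refl (U 0) (g 0) (U 1) (g 1) (g 2) X ⟩
      1# + U 0 * g 0 + U 1 * g 1 + X
        ≈⟨ +-congʳ (trans (sym g₂≈) (sym (*-identityˡ (g 2)))) ⟩
      1# * g 2 + X ∎
    absorb {e = false} {X} ≡.refl ≡.refl ≡.refl =
      solve 4 (λ x y z w → :0 :+ (:0 :* x :+ (:0 :* y :+ (:0 :* z :+ w))) := :0 :* z :+ w) refl (g 0) (g 1) (g 2) X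

  scaled-h≈ : ∀ a → g 2 * h a ≈ (compatible a 0 ◂ 1#) * g 2 + xStep (compatible a) negV′ (λ b → g 2 * h b) (suc K′)
  scaled-h≈ a = begin
    g 2 * h a
      ≈⟨ *-congˡ (h-equation a) ⟩
    g 2 * ((compatible a 0 ◂ 1#) + xStep (compatible a) negV′ h (suc K′))
      ≈⟨ distribˡ _ _ _ ⟩
    g 2 * (compatible a 0 ◂ 1#) + g 2 * xStep (compatible a) negV′ h (suc K′)
      ≈⟨ +-cong (*-comm _ _) (xStep-scale (g 2) (compatible a) negV′ h (suc K′)) ⟩
    (compatible a 0 ◂ 1#) * g 2 + xStep (compatible a) negV′ (λ b → g 2 * h b) (suc K′) ∎

  -- A walk may leave the levels ≥ 3 exactly where a shifted walk may end, and its continuation is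
  -- then counted by g 2, since level 2 may be followed only by level 0, level 1 or the end.
  high≈g₂h : ∀ a → high a ≈ g 2 * h a
  high≈g₂h = xStep-unique {M = compatible} {v = negV′} {suc K′} high≈ scaled-h≈

  toHigh≈ : ∀ {M} → (∀ b → M b ≡ compatible 0 b) → xStep M negV′ high (suc K′) ≈ g 2 * (h 0 - 1#)
  toHigh≈ {M} M≡ = begin
    xStep M negV′ high (suc K′)                           ≈⟨ xStep-row-cong negV′ high (suc K′) M≡ ⟩
    xStep (compatible 0) negV′ high (suc K′)              ≈⟨ xStep-cong (compatible 0) negV′ (suc K′) high≈g₂h ⟩
    xStep (compatible 0) negV′ (λ b → g 2 * h b) (suc K′) ≈⟨ xStep-scale (g 2) (compatible 0) negV′ h (suc K′) ⟨
    g 2 * xStep (compatible 0) negV′ h (suc K′)           ≈⟨ *-congˡ h₀-step ⟩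
    g 2 * (h 0 - 1#)                                      ∎
    where
    h₀-step : xStep (compatible 0) negV′ h (suc K′) ≈ h 0 - 1#
    h₀-step = trans (solve 1 (λ x → x := :1 :+ x :- :1) refl _) (+-congʳ (sym (h-equation 0)))

  toHigh₀≈ : toHigh 0 ≈ g 2 * (h 0 - 1#)
  toHigh₀≈ = toHigh≈ (λ b →
    ≡.trans (compatible-comm 0 (3 ℕ.+ b)) (≡.trans (compatible-high-0 b) (compatible-comm b 0)))

  toHigh₁≈ : toHigh 1 ≈ g 2 * (h 0 - 1#)
  toHigh₁≈ = toHigh≈ (λ b →
    ≡.trans (compatible-comm 1 (3 ℕ.+ b)) (≡.trans (compatible-high-1 b) (compatible-comm b 0)))

  g₁≈ : g 1 ≈ g 2 * (U 2 + h 0 - 1#)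
  g₁≈ = begin
    g 1                                                       ≈⟨ g-split 1 ⟩
    0# + (0# * g 0 + (0# * g 1 + (U 2 * g 2 + toHigh 1)))     ≈⟨ +-congˡ (+-congˡ (+-congˡ (+-congˡ toHigh₁≈))) ⟩
    0# + (0# * g 0 + (0# * g 1 + (U 2 * g 2 + g 2 * (h 0 - 1#))))
      ≈⟨ solve 5 (λ x y u z t → :0 :+ (:0 :* x :+ (:0 :* y :+ (u :* z :+ z :* (t :- :1)))) := z :* (u :+ t :- :1))
           refl (g 0) (g 1) (U 2) (g 2) (h 0) ⟩
    g 2 * (U 2 + h 0 - 1#)                                    ∎

  g₀≈ : g 0 ≈ 1# + U 0 * g 0 + g 1
  g₀≈ = begin
    g 0                                                       ≈⟨ g-split 0 ⟩
    1# + (U 0 * g 0 + (0# * g 1 + (U 2 * g 2 + toHigh 0)))    ≈⟨ +-congˡ (+-congˡ (+-congˡ (+-congˡ toHigh₀≈))) ⟩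
    1# + (U 0 * g 0 + (0# * g 1 + (U 2 * g 2 + g 2 * (h 0 - 1#))))
      ≈⟨ solve 6 (λ u x y v z t → :1 :+ (u :* x :+ (:0 :* y :+ (v :* z :+ z :* (t :- :1))))
                                  := :1 :+ u :* x :+ z :* (v :+ t :- :1)) refl (U 0) (g 0) (g 1) (U 2) (g 2) (h 0) ⟩
    1# + U 0 * g 0 + g 2 * (U 2 + h 0 - 1#)                   ≈⟨ +-congˡ g₁≈ ⟨
    1# + U 0 * g 0 + g 1                                      ∎

  shift₃ : CF R V 3 K′ ≈² CF R V′ 0 K′
  shift₃ = CF-shift 3 V K′

  step : CFIdentity V′ K′ → CFIdentity V (3 ℕ.+ K′)
  step IH = begin
    cfDen R V 0 (3 ℕ.+ K′) * lhsSeries R V (3 ℕ.+ K′)   ≈⟨ *-congˡ lhs≈-g₀ ⟩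
    cfDen R V 0 (3 ℕ.+ K′) * - g 0
      ≈⟨ three-levels (partialDen≋ V 0) (partialDen≋ V 1) (partialDen≋ V 2) g₀≈ g₁≈ g₂≈ IH₃ ⟩
    cfNum R V 0 (3 ℕ.+ K′)                              ∎
    where
    IH₃ : cfDen R V 3 K′ * - h 0 ≈ cfNum R V 3 K′
    IH₃ = begin
      cfDen R V 3 K′ * - h 0               ≈⟨ *-cong (proj₂ shift₃) (sym lhs′≈-h₀) ⟩
      cfDen R V′ 0 K′ * lhsSeries R V′ K′  ≈⟨ IH ⟩
      cfNum R V′ 0 K′                      ≈⟨ proj₁ shift₃ ⟨
      cfNum R V 3 K′                       ∎

module Main {c ℓ} (R : CommutativeRing c ℓ) where
  open PowerSeries R using (seriesRing)
  open ContinuedFractions R using (CFIdentity; partialDen≋)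
  open CommutativeRing seriesRing
  open ContinuantIdentities seriesRing using (one-level)

  cf-identity : ∀ k V → CFIdentity V (3 ℕ.* k)
  cf-identity zero V = trans (*-congˡ (Transfer.lhsSeries≈-transfer R V 0))
    (one-level (partialDen≋ V 0) (TransferEquation.transfer-equation R V 0 0))
  cf-identity (suc k) V = ≡.subst (CFIdentity V) (≡.sym (ℕ.*-suc 3 k))
    (ThreeLevels.step R V (3 ℕ.* k) (cf-identity k (λ a → V (3 ℕ.+ a))))

open import Data.Nat using (_*_)

proposition4p4 : ∀ {c ℓ} (R : CommutativeRing c ℓ) (V : ℕ → CommutativeRing.Carrier R) (k : ℕ) → 1 ≤ k →
    ∀ n → CommutativeRing._≈_ R (mulS R (cfDen R V 0 (3 * k)) (lhsSeries R V (3 * k)) n) (cfNum R V 0 (3 * k) n)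
-- The identity also holds for k = 0.
proposition4p4 R V k _ = Main.cf-identity R k V
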